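{- Let $p$ be a program of the language $\mathcal{W}$ (defined in the context) all of whose executions terminate. Let $E$ be any execution of $p$ and let $M$ be any execution-interpretation of $E$, in which the trace variable $tr$ is interpreted as the trace of $E$. Then every trace axiom $[\![ \mathtt{s} ]\!]$ of trace logic, as it occurs in the formula $[\![ p ]\!]$, holds in $M$; in particular $M \vDash [\![ p ]\!]$, where for $p = \texttt{func main\{}\mathtt{s_1};\dots;\mathtt{s_k}\texttt{\}}$ we set $[\![ p ]\!] := \bigwedge_{i=1}^k [\![ \mathtt{s_i} ]\!]$.
   Context: \textbf{Programs.} A program of $\mathcal{W}$ has the form $\texttt{func main\{}\mathtt{s_1};\dots;\mathtt{s_k}\texttt{\}}$ over a finite set $S_V$ of integer variables and integer-array variables, with side-effect-free integer/boolean expressions. Statements are: $\texttt{skip}$; integer assignments $\mathtt{v = e}$; array assignments $\mathtt{a[e_1] = e_2}$; conditionals $\texttt{if(Cond)\{}\mathtt{s_1};\dots;\mathtt{s_k}\texttt{\} else \{}\mathtt{s'_1};\dots;\mathtt{s'_{k'}}\texttt{\}}$; loops $\texttt{while(Cond)\{}\mathtt{s_1};\dots;\mathtt{s_k}\texttt{\}}$, arbitrarily nested. The while-statements in which a statement $\mathtt{s}$ is nested are its enclosing loops. \textbf{Operational semantics.} A state $\sigma$ maps each integer variable $\mathtt v$ to $\sigma(\mathtt v)\in\mathbb{Z}$ and each array variable $\mathtt a$ and $pos\in\mathbb Z$ to $\sigma(\mathtt a,pos)\in\mathbb Z$. A configuration is $\langle q,\sigma\rangle$ with $q$ a continuation (a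 sequence of statements ending in the marker $end$); while-statements in continuations carry a counter $i\in\mathbb N$, written $\texttt{while}^i$. Steps: $\langle \texttt{skip};q,\sigma\rangle\to\langle q,\sigma\rangle$; $\langle \mathtt{v=e};q,\sigma\rangle\to\langle q,\sigma[\mathtt v\mapsto [\![ \mathtt e]\!](\sigma)]\rangle$; $\langle \mathtt{a[e_1]=e_2};q,\sigma\rangle\to\langle q,\sigma[(\mathtt a,[\![\mathtt{e_1}]\!](\sigma))\mapsto[\![\mathtt{e_2}]\!](\sigma)]\rangle$; $\langle\texttt{if}(c)\{q_1\}\texttt{else}\{q_2\};q,\sigma\rangle\to\langle q_1;q,\sigma\rangle$ if $[\![c]\!](\sigma)$ is true and $\to\langle q_2;q,\sigma\rangle$ otherwise; $\langle \texttt{while}^i(c)\{q_1\};q,\sigma\rangle\to\langle q_1;\texttt{while}^{i+1}(c)\{q_1\};q,\sigma\rangle$ if $[\![c]\!](\sigma)$ is true and $\to\langle q,\sigma\rangle$ otherwise. An execution of $p$ is a finite sequence of such steps from an initial configuration $\langle p',\sigma_0\rangle$ (where $p'$ is $p$ with every loop annotated with counter $0$ and $\sigma_0$ arbitrary) to some $\langle end,\sigma\rangle$. \textbf{Trace logic.} Many-sorted first-order logic with equality $\simeq$, sorts $\mathbb N$ (naturals with $0,\mathrm{succ},\mathrm{pred},<$), $\mathbb I$ (integers with $0,1,\dots,+,*,<$), $\mathbb L$ (timepoints), $\mathbb T$ (traces). Each while-statement $\mathtt w$ has its own variable $it^{\mathtt w}$ of sort $\mathbb N$. For each statement $\mathtt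 s$ with enclosing loops $\mathtt{w_1},\dots,\mathtt{w_k}$ there is a symbol $l_s$ of target sort $\mathbb L$ with $k$ arguments of sort $\mathbb N$ (with $k+1$ if $\mathtt s$ is a while-statement); for each while-statement $\mathtt s$ also a symbol $n_s:\mathbb N^k\to\mathbb N$; and a constant $l_{end}$ of sort $\mathbb L$. Define $tp_{\mathtt s}:=l_s(it^{w_1},\dots,it^{w_k})$ for non-loops, $tp_{\mathtt s}(it):=l_s(it^{w_1},\dots,it^{w_k},it)$ and $lastIt_{\mathtt s}:=n_s(it^{w_1},\dots,it^{w_k})$ for loops; $start_{\mathtt s}:=tp_{\mathtt s}(0)$ if $\mathtt s$ is a loop, else $tp_{\mathtt s}$. Define $end_{\mathtt s}$ as: $start_{\mathtt s'}$ if $\mathtt s'$ follows $\mathtt s$ in the same statement sequence; $end_{\mathtt s'}$ if $\mathtt s$ is the last statement in the if- or else-branch of $\mathtt s'$; $tp_{\mathtt w}(\mathrm{succ}(it^{\mathtt w}))$ if $\mathtt s$ is the last statement of the body of loop $\mathtt w$; $l_{end}$ otherwise. Each integer variable $\mathtt v$ is a function $v:\mathbb L\times\mathbb T\to\mathbb I$, each array $\mathtt a$ a function $a:\mathbb L\times\mathbb I\times\mathbb T\to\mathbb I$; $[\![\mathtt e]\!](tp,tr)$ is the term obtained from expression $\mathtt e$ by replacing each variable by its value at $(tp,tr)$. Let $tr$ be a free variable of sort $\mathbb T$. $Eq(v,tp_1,tp_2)$ is $\forall pos_{\mathbb I}.\,v(tp_1,pos,tr)\simeq v(tp_2,pos,tr)$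 if $\mathtt v$ is an array and $v(tp_1,tr)\simeq v(tp_2,tr)$ otherwise; $EqAll(tp_1,tp_2):=\bigwedge_{v\in S_V}Eq(v,tp_1,tp_2)$. \textbf{Trace axioms.} $[\![\texttt{skip}]\!]:=\bigwedge_{v\in S_V}Eq(v,end_{\mathtt s},tp_{\mathtt s})$. For $\mathtt s=\mathtt{v=e}$: $v(end_{\mathtt s},tr)\simeq[\![\mathtt e]\!](tp_{\mathtt s},tr)\wedge\bigwedge_{v'\in S_V\setminus\{v\}}Eq(v',end_{\mathtt s},tp_{\mathtt s})$. For $\mathtt s=\mathtt{a[e_1]=e_2}$: $\forall pos_{\mathbb I}.(pos\not\simeq e_1(tp_{\mathtt s},tr)\to a(end_{\mathtt s},pos,tr)\simeq a(tp_{\mathtt s},pos,tr))\wedge a(end_{\mathtt s},e_1(tp_{\mathtt s},tr),tr)\simeq e_2(tp_{\mathtt s},tr)\wedge\bigwedge_{v\in S_V\setminus\{a\}}Eq(v,end_{\mathtt s},tp_{\mathtt s})$. For the conditional: $(C\to EqAll(start_{\mathtt{s_1}},tp_{\mathtt s}))\wedge(\neg C\to EqAll(start_{\mathtt{s'_1}},tp_{\mathtt s}))\wedge(C\to\bigwedge_i[\![\mathtt{s_i}]\!])\wedge(\neg C\to\bigwedge_i[\![\mathtt{s'_i}]\!])$ with $C=[\![\mathtt{Cond}]\!](tp_{\mathtt s},tr)$. For the loop $\mathtt s$: $\forall it^s_{\mathbb N}.(it^s<lastIt_{\mathtt s}\to[\![\mathtt{Cond}]\!](tp_{\mathtt s}(it^s),tr))\wedge\neg[\![\mathtt{Cond}]\!](tp_{\mathtt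 s}(lastIt_{\mathtt s}),tr)\wedge\forall it^s_{\mathbb N}.(it^s<lastIt_{\mathtt s}\to EqAll(start_{\mathtt{s_1}},tp_{\mathtt s}(it^s)))\wedge\forall it^s_{\mathbb N}.(it^s<lastIt_{\mathtt s}\to\bigwedge_i[\![\mathtt{s_i}]\!])\wedge EqAll(end_{\mathtt s},tp_{\mathtt s}(lastIt_{\mathtt s}))$. \textbf{Execution-interpretations.} Map ground timepoint terms to continuations by $R(tp_{\mathtt s}):=\mathtt s;R(end_{\mathtt s})$ for non-loops, $R(tp_{\mathtt s}(i)):=\mathtt s^{i};R(end_{\mathtt s})$ for loops (loop annotated with counter $i$), $R(l_{end}):=end$. An execution-interpretation of an execution $E$ is any interpretation $M$ (interpreting $\mathbb N$, $\mathbb I$ standardly) such that whenever a configuration $\langle R(tp),\sigma\rangle$ occurs in $E$, the term $v(tp,tr)$ is interpreted as $\sigma(\mathtt v)$ and $a(tp,pos,tr)$ as $\sigma(\mathtt a,pos)$. -}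

module Defs where

open import Data.Nat using (ℕ; zero; suc; _<_)
open import Data.Integer as ℤ using (ℤ)
open import Data.Fin as Fin using (Fin)
open import Data.Bool using (Bool; true; false; if_then_else_; _∧_; _∨_; not)
open import Data.List using (List; []; _∷_; _++_; [_])
open import Data.List.Membership.Propositional using (_∈_)
open import Data.Maybe using (Maybe; just; nothing)
open import Data.Product using (Σ; _×_; _,_; proj₁; proj₂)
open import Data.Unit using (⊤)
open import Function using (_∘_; id)
open import Relation.Nullary using (¬_; does)
open import Relation.Binary.PropositionalEquality using (_≡_; _≢_)

variable
  ni na : ℕ

-- Syntax of W.  Integer variables are Fin ni, array variables Fin na
-- (S_V is the finite set Fin ni ⊎ Fin na).

data IExp (ni na : ℕ) : Set where
  con   : ℤ → IExp ni na
  var   : Fin ni → IExp ni na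
  arr   : Fin na → IExp ni na → IExp ni na
  plus  : IExp ni na → IExp ni na → IExp ni na
  minus : IExp ni na → IExp ni na → IExp ni na
  times : IExp ni na → IExp ni na → IExp ni na
  neg   : IExp ni na → IExp ni na

data BExp (ni na : ℕ) : Set where
  btrue bfalse : BExp ni na
  lt le eq     : IExp ni na → IExp ni na → BExp ni na
  bnot         : BExp ni na → BExp ni na
  band bor     : BExp ni na → BExp ni na → BExp ni na

data Stmt (ni na : ℕ) : Set where
  skip     : Stmt ni na
  assign   : Fin ni → IExp ni na → Stmt ni na
  arrAssign : Fin na → IExp ni na → IExp ni na → Stmt ni na
  ite      : BExp ni na → List (Stmt ni na) → List (Stmt ni na) → Stmt ni na
  while    : BExp ni na → List (Stmt ni na) → Stmt ni na

Program : ℕ → ℕ → Set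
Program ni na = List (Stmt ni na)

-- statements occurring in continuations: while-statements carry a counter
data AStmt (ni na : ℕ) : Set where
  askip      : AStmt ni na
  aassign    : Fin ni → IExp ni na → AStmt ni na
  aarrAssign : Fin na → IExp ni na → IExp ni na → AStmt ni na
  aite       : BExp ni na → List (AStmt ni na) → List (AStmt ni na) → AStmt ni na
  awhile     : ℕ → BExp ni na → List (AStmt ni na) → AStmt ni na

mutual
  annS : Stmt ni na → AStmt ni na
  annS skip = askip
  annS (assign v e) = aassign v e
  annS (arrAssign a e₁ e₂) = aarrAssign a e₁ e₂
  annS (ite c q₁ q₂) = aite c (annL q₁) (annL q₂)
  annS (while c q) = awhile 0 c (annL q)

  annL : List (Stmt ni na) → List (AStmt ni na)
  annL [] = []
  annL (s ∷ q) = annS s ∷ annL q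

record State (ni na : ℕ) : Set where
  constructor state
  field
    ints : Fin ni → ℤ
    arrs : Fin na → ℤ → ℤ
open State public

evalI : IExp ni na → State ni na → ℤ
evalI (con z) σ = z
evalI (var v) σ = ints σ v
evalI (arr a e) σ = arrs σ a (evalI e σ)
evalI (plus e₁ e₂) σ = evalI e₁ σ ℤ.+ evalI e₂ σ
evalI (minus e₁ e₂) σ = evalI e₁ σ ℤ.- evalI e₂ σ
evalI (times e₁ e₂) σ = evalI e₁ σ ℤ.* evalI e₂ σ
evalI (neg e) σ = ℤ.- evalI e σ

evalB : BExp ni na → State ni na → Bool
evalB btrue σ = true
evalB bfalse σ = false
evalB (lt e₁ e₂) σ = does (evalI e₁ σ ℤ.<? evalI e₂ σ)
evalB (le e₁ e₂) σ = does (evalI e₁ σ ℤ.≤? evalI e₂ σ)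
evalB (eq e₁ e₂) σ = does (evalI e₁ σ ℤ.≟ evalI e₂ σ)
evalB (bnot b) σ = not (evalB b σ)
evalB (band b₁ b₂) σ = evalB b₁ σ ∧ evalB b₂ σ
evalB (bor b₁ b₂) σ = evalB b₁ σ ∨ evalB b₂ σ

updI : State ni na → Fin ni → ℤ → State ni na
updI σ v z = state (λ v' → if does (v' Fin.≟ v) then z else ints σ v') (arrs σ)

updA : State ni na → Fin na → ℤ → ℤ → State ni na
updA σ a i z = state (ints σ)
  (λ a' i' → if does (a' Fin.≟ a) ∧ does (i' ℤ.≟ i) then z else arrs σ a' i')

-- Operational semantics.  A continuation is a list of annotated
-- statements; the empty list plays the role of the marker `end`.

Config : ℕ → ℕ → Set
Config ni na = List (AStmt ni na) × State ni na

data _⟶_ {ni na : ℕ} : Config ni na → Config ni na → Set where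
  sSkip   : ∀ {q σ} → (askip ∷ q , σ) ⟶ (q , σ)
  sAssign : ∀ {v e q σ} → (aassign v e ∷ q , σ) ⟶ (q , updI σ v (evalI e σ))
  sArr    : ∀ {a e₁ e₂ q σ} →
            (aarrAssign a e₁ e₂ ∷ q , σ) ⟶ (q , updA σ a (evalI e₁ σ) (evalI e₂ σ))
  sIfT    : ∀ {c q₁ q₂ q σ} → evalB c σ ≡ true → (aite c q₁ q₂ ∷ q , σ) ⟶ (q₁ ++ q , σ)
  sIfF    : ∀ {c q₁ q₂ q σ} → evalB c σ ≡ false → (aite c q₁ q₂ ∷ q , σ) ⟶ (q₂ ++ q , σ)
  sWhT    : ∀ {i c b q σ} → evalB c σ ≡ true →
            (awhile i c b ∷ q , σ) ⟶ (b ++ awhile (suc i) c b ∷ q , σ)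
  sWhF    : ∀ {i c b q σ} → evalB c σ ≡ false → (awhile i c b ∷ q , σ) ⟶ (q , σ)

data Run {ni na : ℕ} : Config ni na → Set where
  done : ∀ σ → Run ([] , σ)
  step : ∀ {c c'} → c ⟶ c' → Run c' → Run c

configs : ∀ {c : Config ni na} → Run c → List (Config ni na)
configs (done σ) = ([] , σ) ∷ []
configs {c = c} (step _ r) = c ∷ configs r

Execution : Program ni na → Set
Execution p = Σ (State _ _) (λ σ₀ → Run (annL p , σ₀))

AllExecutionsTerminate : Program ni na → Set
AllExecutionsTerminate p = ∀ σ₀ → Run (annL p , σ₀)

-- Statement positions (one timepoint symbol l_s per statement s)

mutual
  data SPos {ni na : ℕ} : Stmt ni na → Set where
    here : ∀ {s} → SPos s
    thn  : ∀ {c q₁ q₂} → LPos q₁ → SPos (ite c q₁ q₂)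
    els  : ∀ {c q₁ q₂} → LPos q₂ → SPos (ite c q₁ q₂)
    body : ∀ {c q} → LPos q → SPos (while c q)

  data LPos {ni na : ℕ} : List (Stmt ni na) → Set where
    hd : ∀ {s q} → SPos s → LPos (s ∷ q)
    tl : ∀ {s q} → LPos q → LPos (s ∷ q)

-- The map R from ground timepoint terms l_s(args) to continuations.
-- args lists the values of it^{w₁},…,it^{wₖ} (outermost first), followed
-- by the own iteration if s is a loop.  `k` is R(end of the enclosing
-- statement list).  Ill-sorted argument lists give `nothing`.
mutual
  RS : (s : Stmt ni na) → SPos s → List ℕ → List (AStmt ni na) → Maybe (List (AStmt ni na))
  RS (while c b) here (i ∷ []) k = just (awhile i c (annL b) ∷ k)
  RS (while c b) here _ k = nothing
  RS skip here [] k = just (annS skip ∷ k)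
  RS (assign v e) here [] k = just (annS (assign v e) ∷ k)
  RS (arrAssign a e₁ e₂) here [] k = just (annS (arrAssign a e₁ e₂) ∷ k)
  RS (ite c q₁ q₂) here [] k = just (annS (ite c q₁ q₂) ∷ k)
  RS _ here (_ ∷ _) k = nothing
  RS (ite c q₁ q₂) (thn lp) args k = RL q₁ lp args k
  RS (ite c q₁ q₂) (els lp) args k = RL q₂ lp args k
  RS (while c b) (body lp) (i ∷ args) k = RL b lp args (awhile (suc i) c (annL b) ∷ k)
  RS (while c b) (body lp) [] k = nothing

  RL : (q : List (Stmt ni na)) → LPos q → List ℕ → List (AStmt ni na) → Maybe (List (AStmt ni na))
  RL (s ∷ q) (hd sp) args k = RS s sp args (annL q ++ k)
  RL (s ∷ q) (tl lp) args k = RL q lp args k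

R : (p : Program ni na) → LPos p → List ℕ → Maybe (List (AStmt ni na))
R p pos args = RL p pos args []

-- Interpretations of the trace-logic signature of p
-- (sorts ℕ and 𝕀 = ℤ interpreted standardly)

record Interp (p : Program ni na) : Set₁ where
  field
    TP    : Set
    Tr    : Set
    lsym  : LPos p → List ℕ → TP
    lend  : TP
    nsym  : LPos p → List ℕ → ℕ          -- n_s (used for loops only)
    ival  : Fin ni → TP → Tr → ℤ
    aval  : Fin na → TP → ℤ → Tr → ℤ
    trace : Tr                           -- value assigned to the free variable tr

record IsExecInterp (p : Program ni na) (E : Execution p) (M : Interp p) : Set where
  open Interp M
  field
    atTP  : ∀ pos args q σ → R p pos args ≡ just q → (q , σ) ∈ configs (proj₂ E) →
            (∀ v → ival v (lsym pos args) trace ≡ ints σ v) ×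
            (∀ a z → aval a (lsym pos args) z trace ≡ arrs σ a z)
    atEnd : ∀ σ → ([] , σ) ∈ configs (proj₂ E) →
            (∀ v → ival v lend trace ≡ ints σ v) ×
            (∀ a z → aval a lend z trace ≡ arrs σ a z)
    atLast : ∀ pos args i c b k σ → R p pos (args ++ [ i ]) ≡ just (awhile i c b ∷ k) →
             (awhile i c b ∷ k , σ) ∈ configs (proj₂ E) → evalB c σ ≡ false →
             nsym pos args ≡ i

module Axioms {p : Program ni na} (M : Interp p) where
  open Interp M

  stateAt : TP → State ni na
  stateAt t = state (λ v → ival v t trace) (λ a z → aval a t z trace)

  EqAll : TP → TP → Set
  EqAll t₁ t₂ = (∀ v → ival v t₁ trace ≡ ival v t₂ trace) ×
                (∀ a z → aval a t₁ z trace ≡ aval a t₂ z trace)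

  Cond : BExp ni na → TP → Set
  Cond c t = evalB c (stateAt t) ≡ true

  -- start_s, for statement s located via f, enclosing iteration values ρ
  startS : (s : Stmt ni na) → (SPos s → LPos p) → List ℕ → TP
  startS (while c b) f ρ = lsym (f here) (ρ ++ [ 0 ])
  startS skip f ρ = lsym (f here) ρ
  startS (assign _ _) f ρ = lsym (f here) ρ
  startS (arrAssign _ _ _) f ρ = lsym (f here) ρ
  startS (ite _ _ _) f ρ = lsym (f here) ρ

  -- start of the first statement of a list; e is the end of the list
  -- (used if the list is empty)
  startL : (q : List (Stmt ni na)) → (LPos q → LPos p) → List ℕ → TP → TP
  startL [] f ρ e = e
  startL (s ∷ q) f ρ e = startS s (f ∘ hd) ρ

  mutual
    -- ⟦s⟧ where e = end_s
    axS : (s : Stmt ni na) → (SPos s → LPos p) → List ℕ → TP → Set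
    axS skip f ρ e = EqAll e (lsym (f here) ρ)
    axS (assign v ex) f ρ e =
      let tp = lsym (f here) ρ in
      ival v e trace ≡ evalI ex (stateAt tp) ×
      (∀ v' → v' ≢ v → ival v' e trace ≡ ival v' tp trace) ×
      (∀ a z → aval a e z trace ≡ aval a tp z trace)
    axS (arrAssign a e₁ e₂) f ρ e =
      let tp = lsym (f here) ρ in
      (∀ z → z ≢ evalI e₁ (stateAt tp) → aval a e z trace ≡ aval a tp z trace) ×
      aval a e (evalI e₁ (stateAt tp)) trace ≡ evalI e₂ (stateAt tp) ×
      (∀ a' → a' ≢ a → ∀ z → aval a' e z trace ≡ aval a' tp z trace) ×
      (∀ v → ival v e trace ≡ ival v tp trace)
    axS (ite c q₁ q₂) f ρ e =
      let tp = lsym (f here) ρ in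
      (Cond c tp → EqAll (startL q₁ (f ∘ thn) ρ e) tp) ×
      (¬ Cond c tp → EqAll (startL q₂ (f ∘ els) ρ e) tp) ×
      (Cond c tp → axL q₁ (f ∘ thn) ρ e) ×
      (¬ Cond c tp → axL q₂ (f ∘ els) ρ e)
    axS (while c b) f ρ e =
      let tpi  = λ it → lsym (f here) (ρ ++ [ it ])
          last = nsym (f here) ρ in
      (∀ it → it < last → Cond c (tpi it)) ×
      ¬ Cond c (tpi last) ×
      (∀ it → it < last → EqAll (startL b (f ∘ body) (ρ ++ [ it ]) (tpi (suc it))) (tpi it)) ×
      (∀ it → it < last → axL b (f ∘ body) (ρ ++ [ it ]) (tpi (suc it))) ×
      EqAll e (tpi last)

    axL : (q : List (Stmt ni na)) → (LPos q → LPos p) → List ℕ → TP → Set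
    axL [] f ρ e = ⊤
    axL (s ∷ q) f ρ e = axS s (f ∘ hd) ρ (startL q (f ∘ tl) ρ e) × axL q (f ∘ tl) ρ e

  ⟦program⟧ : Set
  ⟦program⟧ = axL p id [] lend

⊨⟦_⟧ : (p : Program ni na) → Interp p → Set
⊨⟦ p ⟧ M = Axioms.⟦program⟧ M

-- Follow the execution E along the program.  Whenever E passes a configuration R(tp) the
-- interpretation M agrees with its state at tp, so the axiom of a statement s is an equation
-- between the states of E at R(tp_s) and at R(end_s), and the run of E from R(tp_s) executes
-- s and then reaches R(end_s); the step rules give the equation.  This is an induction on s,
-- carried along a suffix of E.  For a loop, an inner induction on the length of the remaining
-- run walks through the iterations until the guard fails, and the definition of
-- execution-interpretation says that this happens exactly at iteration n_s.
module Submission where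

open import Defs
open import Data.Nat using (ℕ; zero; suc; _<_; _≤_; z≤n; s≤s)
open import Data.Nat.Properties using (≤-refl; ≤-trans; n≤1+n; <⇒≱; m≤n⇒m<n∨m≡n)
import Data.Integer as ℤ
import Data.Fin as Fin
open import Data.Bool using (true; false; not; _∧_; _∨_)
open import Data.List using (List; []; _∷_; _++_; [_])
open import Data.List.Properties using (++-identityʳ; ++-assoc)
open import Data.List.Membership.Propositional using (_∈_)
open import Data.List.Relation.Binary.Subset.Propositional using (_⊆_)
open import Data.List.Relation.Unary.Any using (here; there)
open import Data.Maybe using (just)
open import Data.Product using (Σ; _×_; _,_; proj₁; proj₂)
open import Data.Sum using (inj₁; inj₂)
open import Data.Unit using (tt)
open import Data.Empty using (⊥-elim)
open import Function using (_∘_; id)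
open import Relation.Nullary using (¬_; yes; no; does)
open import Relation.Binary.PropositionalEquality
  using (_≡_; _≢_; refl; sym; trans; cong; cong₂; subst)

module _ {ni na : ℕ} where

  _≈_ : State ni na → State ni na → Set
  σ₁ ≈ σ₂ = (∀ v → ints σ₁ v ≡ ints σ₂ v) × (∀ a z → arrs σ₁ a z ≡ arrs σ₂ a z)

  evalI-cong : ∀ {σ₁ σ₂} → σ₁ ≈ σ₂ → (e : IExp ni na) → evalI e σ₁ ≡ evalI e σ₂
  evalI-cong h (con z) = refl
  evalI-cong h (var v) = proj₁ h v
  evalI-cong {σ₂ = σ₂} h (arr a e) = trans (proj₂ h a _) (cong (arrs σ₂ a) (evalI-cong h e))
  evalI-cong h (plus e₁ e₂) = cong₂ ℤ._+_ (evalI-cong h e₁) (evalI-cong h e₂)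
  evalI-cong h (minus e₁ e₂) = cong₂ ℤ._-_ (evalI-cong h e₁) (evalI-cong h e₂)
  evalI-cong h (times e₁ e₂) = cong₂ ℤ._*_ (evalI-cong h e₁) (evalI-cong h e₂)
  evalI-cong h (neg e) = cong ℤ.-_ (evalI-cong h e)

  evalB-cong : ∀ {σ₁ σ₂} → σ₁ ≈ σ₂ → (b : BExp ni na) → evalB b σ₁ ≡ evalB b σ₂
  evalB-cong h btrue = refl
  evalB-cong h bfalse = refl
  evalB-cong h (lt e₁ e₂) = cong₂ (λ x y → does (x ℤ.<? y)) (evalI-cong h e₁) (evalI-cong h e₂)
  evalB-cong h (le e₁ e₂) = cong₂ (λ x y → does (x ℤ.≤? y)) (evalI-cong h e₁) (evalI-cong h e₂)
  evalB-cong h (eq e₁ e₂) = cong₂ (λ x y → does (x ℤ.≟ y)) (evalI-cong h e₁) (evalI-cong h e₂)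
  evalB-cong h (bnot b) = cong not (evalB-cong h b)
  evalB-cong h (band b₁ b₂) = cong₂ _∧_ (evalB-cong h b₁) (evalB-cong h b₂)
  evalB-cong h (bor b₁ b₂) = cong₂ _∨_ (evalB-cong h b₁) (evalB-cong h b₂)

  updI-same : ∀ (σ : State ni na) v z → ints (updI σ v z) v ≡ z
  updI-same σ v z with v Fin.≟ v
  ... | yes _ = refl
  ... | no v≢v = ⊥-elim (v≢v refl)

  updI-other : ∀ (σ : State ni na) v z v' → v' ≢ v → ints (updI σ v z) v' ≡ ints σ v'
  updI-other σ v z v' v'≢v with v' Fin.≟ v
  ... | yes v'≡v = ⊥-elim (v'≢v v'≡v)
  ... | no _ = refl

  updA-same : ∀ (σ : State ni na) a i z → arrs (updA σ a i z) a i ≡ z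
  updA-same σ a i z with a Fin.≟ a | i ℤ.≟ i
  ... | yes _ | yes _ = refl
  ... | no a≢a | _ = ⊥-elim (a≢a refl)
  ... | yes _ | no i≢i = ⊥-elim (i≢i refl)

  updA-other-pos : ∀ (σ : State ni na) a i z j → j ≢ i → arrs (updA σ a i z) a j ≡ arrs σ a j
  updA-other-pos σ a i z j j≢i with a Fin.≟ a | j ℤ.≟ i
  ... | _ | yes j≡i = ⊥-elim (j≢i j≡i)
  ... | yes _ | no _ = refl
  ... | no _ | no _ = refl

  updA-other-arr : ∀ (σ : State ni na) a i z a' j → a' ≢ a →
                   arrs (updA σ a i z) a' j ≡ arrs σ a' j
  updA-other-arr σ a i z a' j a'≢a with a' Fin.≟ a
  ... | yes a'≡a = ⊥-elim (a'≢a a'≡a)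
  ... | no _ = refl

  length : ∀ {c : Config ni na} → Run c → ℕ
  length (done _) = 0
  length (step _ r) = suc (length r)

module Soundness {ni na : ℕ} (p : Program ni na) (E : Execution p) (M : Interp p)
                 (H : IsExecInterp p E M) where
  open Interp M
  open Axioms M
  open IsExecInterp H

  Occurs : Config ni na → Set
  Occurs c = c ∈ configs (proj₂ E)

  Within : ∀ {c} → Run c → Set
  Within r = configs r ⊆ configs (proj₂ E)

  within-head : ∀ {c} (r : Run c) → Within r → Occurs c
  within-head (done _) w = w (here refl)
  within-head (step _ _) w = w (here refl)

  within-tail : ∀ {c cs} → c ∷ cs ⊆ configs (proj₂ E) → cs ⊆ configs (proj₂ E)
  within-tail w = w ∘ there

  within-subst : ∀ {q q' σ} (q≡q' : q ≡ q') {r : Run (q , σ)} →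
                 Within r → Within (subst (λ w → Run (w , σ)) q≡q' r)
  within-subst refl w = w

  RestFrom : List (AStmt ni na) → State ni na → ℕ → Set
  RestFrom k σ n = Σ (Run (k , σ)) λ r → Within r × length r ≤ n

  Rest : List (AStmt ni na) → ℕ → Set
  Rest k n = Σ (State ni na) λ σ → RestFrom k σ n

  rest-weaken : ∀ {k m n} → m ≤ n → Rest k m → Rest k n
  rest-weaken m≤n (σ , r , w , r≤m) = σ , r , w , ≤-trans r≤m m≤n

  Agrees : TP → State ni na → Set
  Agrees t σ = stateAt t ≈ σ

  Labels : TP → List (AStmt ni na) → Set
  Labels t k = ∀ σ → Occurs (k , σ) → Agrees t σ

  labels-R : ∀ pos args {q} → R p pos args ≡ just q → Labels (lsym pos args) q
  labels-R pos args R≡q σ occ = atTP pos args _ σ R≡q occ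

  EqAll-of-Agrees : ∀ {t₁ t₂ σ} → Agrees t₁ σ → Agrees t₂ σ → EqAll t₁ t₂
  EqAll-of-Agrees (i₁ , a₁) (i₂ , a₂) =
    (λ v → trans (i₁ v) (sym (i₂ v))) , (λ a z → trans (a₁ a z) (sym (a₂ a z)))

  Cond-of-true : ∀ {t σ} c → Agrees t σ → evalB c σ ≡ true → Cond c t
  Cond-of-true c t≈σ c≡true = trans (evalB-cong t≈σ c) c≡true

  ¬Cond-of-false : ∀ {t σ} c → Agrees t σ → evalB c σ ≡ false → ¬ Cond c t
  ¬Cond-of-false c t≈σ c≡false c≡true
    with trans (sym c≡false) (trans (sym (evalB-cong t≈σ c)) c≡true)
  ... | ()

  -- The statement s, reached from the program through f with enclosing iteration values ρ,
  -- is followed by the continuation k in E.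
  LocatedS : (s : Stmt ni na) → (SPos s → LPos p) → List ℕ → List (AStmt ni na) → Set
  LocatedS s f ρ k = ∀ sp args → R p (f sp) (ρ ++ args) ≡ RS s sp args k

  LocatedL : (q : List (Stmt ni na)) → (LPos q → LPos p) → List ℕ → List (AStmt ni na) → Set
  LocatedL q f ρ k = ∀ lp args → R p (f lp) (ρ ++ args) ≡ RL q lp args k

  located-body : ∀ {c b f ρ k} → LocatedS (while c b) f ρ k → ∀ i →
                 LocatedL b (f ∘ body) (ρ ++ [ i ]) (awhile (suc i) c (annL b) ∷ k)
  located-body {f = f} {ρ} h i lp args =
    trans (cong (R p (f (body lp))) (++-assoc ρ [ i ] args)) (h (body lp) (i ∷ args))

  labels-stmt : ∀ s f ρ k → LocatedS s f ρ k → ∀ {q} → RS s here [] k ≡ just q →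
                Labels (lsym (f here) ρ) q
  labels-stmt s f ρ k h RS≡q =
    labels-R (f here) ρ (trans (subst (λ ρ' → R p (f here) ρ' ≡ _) (++-identityʳ ρ) (h here []))
                               RS≡q)

  labels-iteration : ∀ {c b f ρ k} → LocatedS (while c b) f ρ k → ∀ i →
                     Labels (lsym (f here) (ρ ++ [ i ])) (awhile i c (annL b) ∷ k)
  labels-iteration {f = f} {ρ} h i = labels-R (f here) (ρ ++ [ i ]) (h here [ i ])

  labels-startS : ∀ s f ρ k → LocatedS s f ρ k → Labels (startS s f ρ) (annS s ∷ k)
  labels-startS skip f ρ k h = labels-stmt skip f ρ k h refl
  labels-startS (assign v e) f ρ k h = labels-stmt (assign v e) f ρ k h refl
  labels-startS (arrAssign a e₁ e₂) f ρ k h = labels-stmt (arrAssign a e₁ e₂) f ρ k h refl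
  labels-startS (ite c q₁ q₂) f ρ k h = labels-stmt (ite c q₁ q₂) f ρ k h refl
  labels-startS (while c b) f ρ k h = labels-iteration h 0

  labels-startL : ∀ q f ρ e k → LocatedL q f ρ k → Labels e k →
                  Labels (startL q f ρ e) (annL q ++ k)
  labels-startL [] f ρ e k h e↦k = e↦k
  labels-startL (s ∷ q) f ρ e k h e↦k = labels-startS s (f ∘ hd) ρ (annL q ++ k) (h ∘ hd)

  skip-sound : ∀ f ρ e {σ} → Agrees (lsym (f here) ρ) σ → Agrees e σ → axS skip f ρ e
  skip-sound f ρ e before after = EqAll-of-Agrees after before

  assign-sound : ∀ v ex f ρ e {σ} → Agrees (lsym (f here) ρ) σ →
                 Agrees e (updI σ v (evalI ex σ)) → axS (assign v ex) f ρ e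
  assign-sound v ex f ρ e {σ} before after =
    trans (proj₁ after v) (trans (updI-same σ v _) (sym (evalI-cong before ex))) ,
    (λ v' v'≢v → trans (proj₁ after v')
                   (trans (updI-other σ v _ v' v'≢v) (sym (proj₁ before v')))) ,
    (λ a z → trans (proj₂ after a z) (sym (proj₂ before a z)))

  arrAssign-sound : ∀ a e₁ e₂ f ρ e {σ} → Agrees (lsym (f here) ρ) σ →
                    Agrees e (updA σ a (evalI e₁ σ) (evalI e₂ σ)) → axS (arrAssign a e₁ e₂) f ρ e
  arrAssign-sound a e₁ e₂ f ρ e {σ} before after =
    (λ z z≢i → trans (proj₂ after a z)
                 (trans (updA-other-pos σ a _ _ z (λ z≡i → z≢i (trans z≡i (sym i≡i))))
                        (sym (proj₂ before a z)))) ,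
    trans (cong (λ i → aval a e i trace) i≡i)
          (trans (proj₂ after a _) (trans (updA-same σ a _ _) (sym (evalI-cong before e₂)))) ,
    (λ a' a'≢a z → trans (proj₂ after a' z)
                     (trans (updA-other-arr σ a _ _ a' z a'≢a) (sym (proj₂ before a' z)))) ,
    (λ v → trans (proj₁ after v) (sym (proj₁ before v)))
    where
      i≡i : evalI e₁ (stateAt (lsym (f here) ρ)) ≡ evalI e₁ σ
      i≡i = evalI-cong before e₁

  ite-sound-then : ∀ c q₁ q₂ f ρ e → let tp = lsym (f here) ρ in Cond c tp →
                   EqAll (startL q₁ (f ∘ thn) ρ e) tp → axL q₁ (f ∘ thn) ρ e →
                   axS (ite c q₁ q₂) f ρ e
  ite-sound-then c q₁ q₂ f ρ e C start ax =
    (λ _ → start) , (λ ¬C → ⊥-elim (¬C C)) , (λ _ → ax) , (λ ¬C → ⊥-elim (¬C C))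

  ite-sound-else : ∀ c q₁ q₂ f ρ e → let tp = lsym (f here) ρ in ¬ Cond c tp →
                   EqAll (startL q₂ (f ∘ els) ρ e) tp → axL q₂ (f ∘ els) ρ e →
                   axS (ite c q₁ q₂) f ρ e
  ite-sound-else c q₁ q₂ f ρ e ¬C start ax =
    (λ C → ⊥-elim (¬C C)) , (λ _ → start) , (λ C → ⊥-elim (¬C C)) , (λ _ → ax)

  Iteration : ∀ c b → (SPos (while c b) → LPos p) → List ℕ → ℕ → Set
  Iteration c b f ρ it =
    Cond c (tp it) × EqAll (startL b (f ∘ body) (ρ ++ [ it ]) (tp (suc it))) (tp it) ×
    axL b (f ∘ body) (ρ ++ [ it ]) (tp (suc it))
    where
      tp : ℕ → TP
      tp i = lsym (f here) (ρ ++ [ i ])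

  while-sound : ∀ c b f ρ e j → nsym (f here) ρ ≡ j →
                (∀ it → it < j → Iteration c b f ρ it) →
                ¬ Cond c (lsym (f here) (ρ ++ [ j ])) → EqAll e (lsym (f here) (ρ ++ [ j ])) →
                axS (while c b) f ρ e
  while-sound c b f ρ e _ refl its ¬C exit =
    (λ it lt → proj₁ (its it lt)) , ¬C ,
    (λ it lt → proj₁ (proj₂ (its it lt))) , (λ it lt → proj₂ (proj₂ (its it lt))) , exit

  LoopExit : ∀ c b → (SPos (while c b) → LPos p) → List ℕ → List (AStmt ni na) → ℕ → ℕ → Set
  LoopExit c b f ρ k i n =
    Σ ℕ λ j → (∀ it → i ≤ it → it < j → Iteration c b f ρ it) ×
      Σ (State ni na) λ σ → Occurs (awhile j c (annL b) ∷ k , σ) × evalB c σ ≡ false ×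
        RestFrom k σ n

  prepend-iteration : ∀ {P : ℕ → Set} {i j} → P i → (∀ it → suc i ≤ it → it < j → P it) →
                      ∀ it → i ≤ it → it < j → P it
  prepend-iteration Pi Ps it i≤it it<j with m≤n⇒m<n∨m≡n i≤it
  ... | inj₁ i<it = Ps it i<it it<j
  ... | inj₂ refl = Pi

  agrees-before : ∀ s f ρ k → LocatedS s f ρ k → ∀ {σ} (r : Run (annS s ∷ k , σ)) → Within r →
                  Agrees (startS s f ρ) σ
  agrees-before s f ρ k h r w = labels-startS s f ρ k h _ (within-head r w)

  agrees-after : ∀ {e k c σ} → Labels e k → (r : Run (k , σ)) →
                 c ∷ configs r ⊆ configs (proj₂ E) → Agrees e σ
  agrees-after e↦k r w = e↦k _ (within-head r (within-tail w))

  rest-after-step : ∀ {k c σ} (r : Run (k , σ)) → c ∷ configs r ⊆ configs (proj₂ E) →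
                    Rest k (suc (length r))
  rest-after-step r w = _ , r , within-tail w , n≤1+n _

  mutual
    axS-holds : ∀ s f ρ e k → LocatedS s f ρ k → Labels e k →
                ∀ {σ} (r : Run (annS s ∷ k , σ)) → Within r → axS s f ρ e × Rest k (length r)
    axS-holds skip f ρ e k h e↦k (step sSkip r) w =
      skip-sound f ρ e (agrees-before skip f ρ k h (step sSkip r) w)
        (agrees-after e↦k r w) , rest-after-step r w
    axS-holds (assign v ex) f ρ e k h e↦k (step sAssign r) w =
      assign-sound v ex f ρ e (agrees-before _ f ρ k h (step sAssign r) w)
        (agrees-after e↦k r w) , rest-after-step r w
    axS-holds (arrAssign a e₁ e₂) f ρ e k h e↦k (step sArr r) w =
      arrAssign-sound a e₁ e₂ f ρ e (agrees-before _ f ρ k h (step sArr r) w)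
        (agrees-after e↦k r w) , rest-after-step r w
    axS-holds (ite c q₁ q₂) f ρ e k h e↦k {σ} (step (sIfT c≡true) r) w =
      let tp≈σ = agrees-before _ f ρ k h (step (sIfT c≡true) r) w
          ax , rest = axL-holds q₁ (f ∘ thn) ρ e k (h ∘ thn) e↦k r (within-tail w)
          start≈σ = labels-startL q₁ (f ∘ thn) ρ e k (h ∘ thn) e↦k σ (within-head r (within-tail w))
      in ite-sound-then c q₁ q₂ f ρ e (Cond-of-true c tp≈σ c≡true)
           (EqAll-of-Agrees start≈σ tp≈σ) ax , rest-weaken (n≤1+n _) rest
    axS-holds (ite c q₁ q₂) f ρ e k h e↦k {σ} (step (sIfF c≡false) r) w =
      let tp≈σ = agrees-before _ f ρ k h (step (sIfF c≡false) r) w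
          ax , rest = axL-holds q₂ (f ∘ els) ρ e k (h ∘ els) e↦k r (within-tail w)
          start≈σ = labels-startL q₂ (f ∘ els) ρ e k (h ∘ els) e↦k σ (within-head r (within-tail w))
      in ite-sound-else c q₁ q₂ f ρ e (¬Cond-of-false c tp≈σ c≡false)
           (EqAll-of-Agrees start≈σ tp≈σ) ax , rest-weaken (n≤1+n _) rest
    axS-holds (while c b) f ρ e k h e↦k r w
      with loop-exits c b f ρ k h 0 r w (length r) ≤-refl
    ... | j , its , σ , occ , c≡false , rest@(r' , w' , _) =
      while-sound c b f ρ e j (atLast (f here) ρ j c (annL b) k σ (h here [ j ]) occ c≡false)
        (λ it → its it z≤n)
        (¬Cond-of-false c exit≈σ c≡false)
        (EqAll-of-Agrees (e↦k σ (within-head r' w')) exit≈σ) ,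
      σ , rest
      where
        exit≈σ : Agrees (lsym (f here) (ρ ++ [ j ])) σ
        exit≈σ = labels-iteration h j σ occ

    axL-holds : ∀ q f ρ e k → LocatedL q f ρ k → Labels e k →
                ∀ {σ} (r : Run (annL q ++ k , σ)) → Within r → axL q f ρ e × Rest k (length r)
    axL-holds [] f ρ e k h e↦k r w = tt , (_ , r , w , ≤-refl)
    axL-holds (s ∷ q) f ρ e k h e↦k r w =
      let axs , _ , r₁ , w₁ , r₁≤r =
            axS-holds s (f ∘ hd) ρ (startL q (f ∘ tl) ρ e) (annL q ++ k) (h ∘ hd)
              (labels-startL q (f ∘ tl) ρ e k (h ∘ tl) e↦k) r w
          axq , rest = axL-holds q (f ∘ tl) ρ e k (h ∘ tl) e↦k r₁ w₁
      in (axs , axq) , rest-weaken r₁≤r rest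

    -- n bounds the length of the remaining run, which shrinks with every iteration.
    loop-exits : ∀ c b f ρ k → LocatedS (while c b) f ρ k → ∀ i {σ}
                 (r : Run (awhile i c (annL b) ∷ k , σ)) → Within r → ∀ n → length r ≤ n →
                 LoopExit c b f ρ k i (length r)
    loop-exits c b f ρ k h i {σ} (step (sWhF c≡false) r) w n _ =
      i , (λ it i≤it it<i → ⊥-elim (<⇒≱ it<i i≤it)) ,
      σ , within-head (step (sWhF c≡false) r) w , c≡false , r , within-tail w , n≤1+n _
    loop-exits c b f ρ k h i (step (sWhT _) r) w zero ()
    loop-exits c b f ρ k h i {σ} (step (sWhT c≡true) r) w (suc n) (s≤s r≤n) =
      let tp≈σ = labels-iteration h i σ (within-head (step (sWhT c≡true) r) w)
          start≈σ = labels-startL b (f ∘ body) (ρ ++ [ i ]) _ _ (located-body h i)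
                      (labels-iteration h (suc i)) σ (within-head r (within-tail w))
          ax , _ , r₁ , w₁ , r₁≤r =
            axL-holds b (f ∘ body) (ρ ++ [ i ]) _ _ (located-body h i)
              (labels-iteration h (suc i)) r (within-tail w)
          j , its , σⱼ , occ , c≡false , r' , w' , r'≤r₁ =
            loop-exits c b f ρ k h (suc i) r₁ w₁ n (≤-trans r₁≤r r≤n)
      in j ,
         prepend-iteration (Cond-of-true c tp≈σ c≡true , EqAll-of-Agrees start≈σ tp≈σ , ax) its ,
         σⱼ , occ , c≡false , r' , w' , ≤-trans r'≤r₁ (≤-trans r₁≤r (n≤1+n _))

theorem1 : ∀ {ni na : ℕ} (p : Program ni na) → AllExecutionsTerminate p →
    (E : Execution p) (M : Interp p) → IsExecInterp p E M → ⊨⟦ p ⟧ M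
theorem1 p _ E@(σ₀ , r) M H =
  proj₁ (axL-holds p id [] (Interp.lend M) [] (λ _ _ → refl) (IsExecInterp.atEnd H)
           (subst (λ q → Run (q , σ₀)) p≡p++[] r) (within-subst p≡p++[] id))
  where
    open Soundness p E M H
    p≡p++[] : annL p ≡ annL p ++ []
    p≡p++[] = sym (++-identityʳ (annL p))
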